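{- Let $\mathbb{H}$ be a finite $\tau$-structure with universe $H$ and $J\subseteq H$. If $\mathbb{H}^2$ dismantles to a substructure $\mathbb{K}$ whose universe $K$ satisfies $\Delta(J^2)\subseteq K\subseteq\Delta(H^2)$, then $\mathbb{H}$ dismantles to a substructure $\mathbb{I}$ whose universe contains $J$ and such that $\mathbb{I}^2$ dismantles to its diagonal.
   Context: A signature $\tau$ is a set of relation symbols with arities; a $\tau$-structure has a countable universe and relations $R(\cdot)\subseteq(\text{universe})^k$ for $k$-ary $R\in\tau$. $b$ dominates $a$ in $\mathbb{H}$ if for every $k$-ary $R$, every $i$, and every $(a_1,\dots,a_k)\in R(\mathbb{H})$ with $a_i=a$, $(a_1,\dots,a_{i-1},b,a_{i+1},\dots,a_k)\in R(\mathbb{H})$. $\mathbb{J}_0$ dismantles to $\mathbb{J}_\ell$ if there is a sequence $\mathbb{J}_0,\dots,\mathbb{J}_\ell$ ($\ell\ge0$) where each $\mathbb{J}_{j+1}$ is the substructure of $\mathbb{J}_j$ induced by $J_j\setminus\{a_j\}$ (i.e. $R(\mathbb{J}_{j+1})=R(\mathbb{J}_j)\cap J_{j+1}^k$) for some $a_j$ dominated in $\mathbb{J}_j$ by some $b_j\neq a_j$. $\mathbb{H}^2$ is the product structure on $H\times H$ (a tuple of pairs lies in $R(\mathbb{H}^2)$ iff both coordinate tuples lie in $R(\mathbb{H})$). $\Delta(H^2)=\{(a,a):a\in H\}$, $\Delta(J^2)=\{(a,a):a\in J\}$; the diagonal of $\mathbb{I}^2$ is its substructure induced by $\{(a,a):a\in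 I\}$. -}

module Defs where

open import Level using (0ℓ)
open import Data.Nat using (ℕ)
open import Data.Fin using (Fin)
open import Data.Vec using (Vec; lookup; map; _[_]≔_)
open import Data.Vec.Relation.Unary.All using (All)
open import Data.Product using (_×_; proj₁; proj₂)
open import Relation.Unary using (Pred)
open import Relation.Binary.PropositionalEquality using (_≡_; _≢_)

record Signature : Set₁ where
  field
    Sym   : Set
    arity : Sym → ℕ
open Signature public

record Structure (τ : Signature) (A : Set) : Set₁ where
  field
    univ : Pred A 0ℓ
    rel  : (R : Sym τ) → Pred (Vec A (arity τ R)) 0ℓ
open Structure public

module _ {τ : Signature} {A : Set} where

  induced : Structure τ A → Pred A 0ℓ → Structure τ A
  induced S U = record
    { univ = λ x → univ S x × U x
    ; rel  = λ R t → rel S R t × All U t }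

  remove : Structure τ A → A → Structure τ A
  remove S a = induced S (λ x → x ≢ a)

  Dominates : Structure τ A → A → A → Set
  Dominates S a b =
    (R : Sym τ) (t : Vec A (arity τ R)) (i : Fin (arity τ R)) →
    rel S R t → lookup t i ≡ a → rel S R (t [ i ]≔ b)

  data Dismantles (S : Structure τ A) (V : Pred A 0ℓ) : Set₁ where
    stop : (∀ x → univ S x → V x) → (∀ x → V x → univ S x) → Dismantles S V
    step : (a b : A) → univ S a → univ S b → b ≢ a → Dominates S a b →
           Dismantles (remove S a) V → Dismantles S V

  Square : Structure τ A → Structure τ (A × A)
  Square S = record
    { univ = λ p → univ S (proj₁ p) × univ S (proj₂ p)
    ; rel  = λ R t → rel S R (map proj₁ t) × rel S R (map proj₂ t) }

-- If S dismantles to T and ρ retracts S onto a set W ⊇ T, then S[W] dismantles to T: a step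
-- removing a dominated by b is mirrored in S[W] by removing a dominated by ρ b, except when
-- ρ b = a, where one first exchanges a and b. The retraction (x , y) ↦ (x , x) of H² onto its
-- diagonal, which is isomorphic to H, turns H² ↠ K into H ↠ I for I = {a ∣ (a , a) ∈ K}. The
-- folds of that dismantling compose to a retraction g of H onto I, so g × g retracts H² onto
-- I × I, and (H[I])² ≅ H²[I × I] dismantles to K, the diagonal of I².
module Submission where

open import Level using (0ℓ)
open import Data.Nat using (ℕ)
open import Data.Fin using (Fin; zero; suc)
import Data.Fin.Properties as Fin
open import Data.Product using (Σ; ∃; _×_; _,_; proj₁; proj₂; swap; map₂)
import Data.Product.Properties as Product
open import Data.Empty using (⊥-elim)
open import Data.Vec using (Vec; []; _∷_; map; lookup; _[_]≔_)
open import Data.Vec.Properties using (map-id; map-∘; map-[]≔; lookup-map)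
open import Data.Vec.Relation.Unary.All as All using (All; []; _∷_)
open import Data.Vec.Relation.Unary.All.Properties using (map⁺; map⁻)
open import Function using (id; _∘_)
open import Relation.Binary.Definitions using (DecidableEquality)
open import Relation.Binary.PropositionalEquality
  using (_≡_; _≢_; refl; sym; trans; cong; cong₂; subst; module ≡-Reasoning)
open import Relation.Nullary using (yes; no)
open import Relation.Nullary.Decidable using (map′; ¬?)
open import Relation.Unary using (Pred; Decidable; _⊆_; _≐_; _∩_; _⟨×⟩_)
open import Relation.Unary.Properties using (_∩?_; _×?_)

open import Defs

private
  variable
    A B : Set
    τ : Signature
    S : Structure τ A
    U V : Pred A 0ℓ

map-cong-All : {P : Pred A 0ℓ} {f g : A → B} → (∀ {x} → P x → f x ≡ g x) →
               ∀ {k} {t : Vec A k} → All P t → map f t ≡ map g t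
map-cong-All f≡g []         = refl
map-cong-All f≡g (px ∷ pxs) = cong₂ _∷_ (f≡g px) (map-cong-All f≡g pxs)

map-fix : {P : Pred A 0ℓ} {f : A → A} → (∀ {x} → P x → f x ≡ x) →
          ∀ {k} {t : Vec A k} → All P t → map f t ≡ t
map-fix fix pt = trans (map-cong-All fix pt) (map-id _)

module Replacement {A : Set} (_≟_ : DecidableEquality A) where

  replace : A → A → A → A
  replace a c x with x ≟ a
  ... | yes _ = c
  ... | no  _ = x

  replace-elim : ∀ {a c} (P : Pred A 0ℓ) x → (x ≡ a → P c) → (x ≢ a → P x) →
                 P (replace a c x)
  replace-elim {a} P x hit miss with x ≟ a
  ... | yes x≡a = hit x≡a
  ... | no  x≢a = miss x≢a

  replace-same : ∀ a c → replace a c a ≡ c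
  replace-same a c = replace-elim (_≡ c) a (λ _ → refl) (λ a≢a → ⊥-elim (a≢a refl))

  replace-other : ∀ {a c x} → x ≢ a → replace a c x ≡ x
  replace-other {x = x} x≢a = replace-elim (_≡ x) x (λ x≡a → ⊥-elim (x≢a x≡a)) (λ _ → refl)

  replace-≢ : ∀ {a c} → c ≢ a → ∀ x → replace a c x ≢ a
  replace-≢ c≢a x = replace-elim (_≢ _) x (λ _ → c≢a) id

  replace-all : ∀ {a c k} (P : Pred (Vec A k) 0ℓ) →
                (∀ t i → P t → lookup t i ≡ a → P (t [ i ]≔ c)) →
                ∀ t → P t → P (map (replace a c) t)
  replace-all P replace-one [] p = p
  replace-all {a} {c} P replace-one (x ∷ t) p =
    replace-elim (λ y → P (y ∷ map (replace a c) t)) x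
      (replace-one (x ∷ map (replace a c) t) zero tail-replaced)
      (λ _ → tail-replaced)
    where
    tail-replaced : P (x ∷ map (replace a c) t)
    tail-replaced = replace-all (P ∘ (x ∷_)) (λ s i → replace-one (x ∷ s) (suc i)) t p

  transpose : A → A → A → A
  transpose a b x with x ≟ a
  ... | yes _ = b
  ... | no  _ = replace b a x

  transpose-first : ∀ a b → transpose a b a ≡ b
  transpose-first a b with a ≟ a
  ... | yes _   = refl
  ... | no  a≢a = ⊥-elim (a≢a refl)

  transpose-second : ∀ {a b} → b ≢ a → transpose a b b ≡ a
  transpose-second {a} {b} b≢a with b ≟ a
  ... | yes b≡a = ⊥-elim (b≢a b≡a)
  ... | no  _   = replace-same b a

  transpose-other : ∀ {a b x} → x ≢ a → x ≢ b → transpose a b x ≡ x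
  transpose-other {a} {b} {x} x≢a x≢b with x ≟ a
  ... | yes x≡a = ⊥-elim (x≢a x≡a)
  ... | no  _   = replace-other x≢b

  three-cases : ∀ a b (P : Pred A 0ℓ) → P a → P b → (∀ {x} → x ≢ a → x ≢ b → P x) → ∀ x → P x
  three-cases a b P pa pb other x with x ≟ a | x ≟ b
  ... | yes refl | _        = pa
  ... | no  _    | yes refl = pb
  ... | no  x≢a  | no  x≢b  = other x≢a x≢b

  transpose-involutive : ∀ {a b} → b ≢ a → ∀ x → transpose a b (transpose a b x) ≡ x
  transpose-involutive {a} {b} b≢a = three-cases a b (λ x → transpose a b (transpose a b x) ≡ x)
    (trans (cong (transpose a b) (transpose-first a b)) (transpose-second b≢a))
    (trans (cong (transpose a b) (transpose-second b≢a)) (transpose-first a b))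
    (λ x≢a x≢b → trans (cong (transpose a b) (transpose-other x≢a x≢b)) (transpose-other x≢a x≢b))

  transpose≡replace : ∀ {a b} → b ≢ a → ∀ {x} → x ≢ b → transpose a b x ≡ replace a b x
  transpose≡replace {a} {b} b≢a {x} =
    three-cases a b (λ x → x ≢ b → transpose a b x ≡ replace a b x)
    (λ _ → trans (transpose-first a b) (sym (replace-same a b)))
    (λ b≢b → ⊥-elim (b≢b refl))
    (λ x≢a x≢b _ → trans (transpose-other x≢a x≢b) (sym (replace-other x≢a))) x

-- Defs allows relations to mention elements outside the universe; the identity retracts
-- a structure onto its universe only when they do not.
Closed : Structure τ A → Set
Closed S = ∀ R → rel S R ⊆ All (univ S)

induced-closed : Closed S → Closed (induced S U)
induced-closed closed R (r , tU) = All.zip (closed R r , tU)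

dismantles-⊆ : Dismantles S V → V ⊆ univ S
dismantles-⊆ (stop _ V⊆S)         = V⊆S _
dismantles-⊆ (step _ _ _ _ _ _ d) = λ v → proj₁ (dismantles-⊆ d v)

dismantles-decidable : {S : Structure τ A} {V : Pred A 0ℓ} →
                       DecidableEquality A → Decidable (univ S) → Dismantles S V → Decidable V
dismantles-decidable _   S? (stop S⊆V V⊆S) x = map′ (S⊆V x) (V⊆S x) (S? x)
dismantles-decidable _≟_ S? (step a _ _ _ _ _ d) =
  dismantles-decidable _≟_ (S? ∩? λ x → ¬? (x ≟ a)) d

dismantles-respʳ-≐ : {S : Structure τ A} {V V′ : Pred A 0ℓ} →
                     V ≐ V′ → Dismantles S V → Dismantles S V′
dismantles-respʳ-≐ (V⊆V′ , V′⊆V) (stop S⊆V V⊆S) =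
  stop (λ x u → V⊆V′ (S⊆V x u)) (λ x v → V⊆S x (V′⊆V v))
dismantles-respʳ-≐ V≐V′ (step a b ua ub b≢a dom d) =
  step a b ua ub b≢a dom (dismantles-respʳ-≐ V≐V′ d)

record IsIsomorphism (S : Structure τ A) (S′ : Structure τ B) (e : A → B) : Set where
  field
    injective : ∀ {x y} → e x ≡ e y → x ≡ y
    onto      : ∀ {y} → univ S′ y → ∃ λ x → e x ≡ y
    univ-≐    : univ S ≐ univ S′ ∘ e
    rel-≐     : ∀ R → rel S R ≐ rel S′ R ∘ map e

module _ {S : Structure τ A} {S′ : Structure τ B} {e : A → B} (iso : IsIsomorphism S S′ e) where
  open IsIsomorphism iso

  dominates-transport : ∀ {a b} → Dominates S′ (e a) (e b) → Dominates S a b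
  dominates-transport dom R t i r t[i]≡a =
    proj₂ (rel-≐ R) (subst (rel S′ R) (sym (map-[]≔ e t i))
      (dom R (map e t) i (proj₁ (rel-≐ R) r) (trans (lookup-map i e t) (cong e t[i]≡a))))

  remove-isomorphism : ∀ a → IsIsomorphism (remove S a) (remove S′ (e a)) e
  remove-isomorphism a = record
    { injective = injective
    ; onto      = λ (u , _) → onto u
    ; univ-≐    = (λ (u , x≢a) → proj₁ univ-≐ u , x≢a ∘ injective)
                , (λ (u , ex≢ea) → proj₂ univ-≐ u , ex≢ea ∘ cong e)
    ; rel-≐     = λ R → (λ (r , t≢a) → proj₁ (rel-≐ R) r , map⁺ (All.map (_∘ injective) t≢a))
                      , (λ (r , t≢a) → proj₂ (rel-≐ R) r , All.map (_∘ cong e) (map⁻ t≢a))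
    }

dismantles-transport : {S : Structure τ A} {S′ : Structure τ B} {e : A → B} {V : Pred B 0ℓ} →
                       IsIsomorphism S S′ e → Dismantles S′ V → Dismantles S (V ∘ e)
dismantles-transport iso (stop S′⊆V V⊆S′) =
  stop (λ _ u → S′⊆V _ (proj₁ univ-≐ u)) (λ _ v → proj₂ univ-≐ (V⊆S′ _ v))
  where open IsIsomorphism iso
dismantles-transport {e = e} iso (step _ _ ua ub b≢a dom d)
  with IsIsomorphism.onto iso ua | IsIsomorphism.onto iso ub
... | a , refl | b , refl =
  step a b (proj₂ univ-≐ ua) (proj₂ univ-≐ ub) (b≢a ∘ cong e) (dominates-transport iso dom)
       (dismantles-transport (remove-isomorphism iso a) d)
  where open IsIsomorphism iso

record _≈_ (S S′ : Structure τ A) : Set where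
  field
    univ-≈ : univ S ≐ univ S′
    rel-≈  : ∀ R → rel S R ≐ rel S′ R
open _≈_

≈-sym : {S′ : Structure τ A} → S ≈ S′ → S′ ≈ S
≈-sym S≈S′ = record { univ-≈ = swap (univ-≈ S≈S′) ; rel-≈ = swap ∘ rel-≈ S≈S′ }

≈⇒isomorphism : {S′ : Structure τ A} → S ≈ S′ → IsIsomorphism S S′ id
≈⇒isomorphism {S′ = S′} S≈S′ = record
  { injective = id
  ; onto      = λ {y} _ → y , refl
  ; univ-≐    = univ-≈ S≈S′
  ; rel-≐     = λ R → (λ r → subst (rel S′ R) (sym (map-id _)) (proj₁ (rel-≈ S≈S′ R) r))
                    , (λ r → proj₂ (rel-≈ S≈S′ R) (subst (rel S′ R) (map-id _) r))
  }

dismantles-respˡ-≈ : {S′ : Structure τ A} → S ≈ S′ → Dismantles S′ V → Dismantles S V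
dismantles-respˡ-≈ S≈S′ = dismantles-transport (≈⇒isomorphism S≈S′)

induced-∩ : induced (induced S U) V ≈ induced S (U ∩ V)
induced-∩ = record
  { univ-≈ = (λ ((u , x∈U) , x∈V) → u , x∈U , x∈V) , (λ (u , x∈U , x∈V) → (u , x∈U) , x∈V)
  ; rel-≈  = λ R → (λ ((r , tU) , tV) → r , All.zip (tU , tV))
                 , (λ (r , tUV) → (r , proj₁ (All.unzip tUV)) , proj₂ (All.unzip tUV))
  }

induced-cong : U ≐ V → induced S U ≈ induced S V
induced-cong (U⊆V , V⊆U) = record
  { univ-≈ = map₂ U⊆V , map₂ V⊆U
  ; rel-≈  = λ R → map₂ (All.map U⊆V) , map₂ (All.map V⊆U)
  }

square-induced : Square (induced S U) ≈ induced (Square S) (U ⟨×⟩ U)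
square-induced = record
  { univ-≈ = (λ ((u₁ , x₁∈U) , (u₂ , x₂∈U)) → (u₁ , u₂) , x₁∈U , x₂∈U)
           , (λ ((u₁ , u₂) , x₁∈U , x₂∈U) → (u₁ , x₁∈U) , (u₂ , x₂∈U))
  ; rel-≈  = λ R → (λ ((r₁ , t₁∈U) , (r₂ , t₂∈U)) → (r₁ , r₂) , All.zip (map⁻ t₁∈U , map⁻ t₂∈U))
                 , (λ ((r₁ , r₂) , t∈U×U) → (r₁ , map⁺ (proj₁ (All.unzip t∈U×U)))
                                          , (r₂ , map⁺ (proj₂ (All.unzip t∈U×U))))
  }

Diagonal : Pred (A × A) 0ℓ
Diagonal p = proj₁ p ≡ proj₂ p

diagonal : A → A × A
diagonal x = x , x

diagonal-isomorphism : {S : Structure τ A} → IsIsomorphism S (induced (Square S) Diagonal) diagonal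
diagonal-isomorphism {A = A} {S = S} = record
  { injective = cong proj₁
  ; onto      = λ {(x , _)} (_ , x≡y) → x , cong (x ,_) x≡y
  ; univ-≐    = (λ u → (u , u) , refl) , λ ((u , _) , _) → u
  ; rel-≐     = λ R → (λ {t} r → (subst (rel S R) (sym (proj₁-diagonal t)) r
                                 , subst (rel S R) (sym (proj₂-diagonal t)) r)
                               , map⁺ (All.universal (λ _ → refl) t))
                    , (λ {t} ((r , _) , _) → subst (rel S R) (proj₁-diagonal t) r)
  }
  where
  proj₁-diagonal : ∀ {k} (t : Vec A k) → map proj₁ (map diagonal t) ≡ t
  proj₁-diagonal t = trans (sym (map-∘ proj₁ diagonal t)) (map-id t)

  proj₂-diagonal : ∀ {k} (t : Vec A k) → map proj₂ (map diagonal t) ≡ t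
  proj₂-diagonal t = trans (sym (map-∘ proj₂ diagonal t)) (map-id t)

record Retraction (S : Structure τ A) (W : Pred A 0ℓ) (ρ : A → A) : Set where
  field
    into      : univ S ⊆ univ (induced S W) ∘ ρ
    fixes     : ∀ {x} → W x → ρ x ≡ x
    preserves : ∀ R → rel S R ⊆ rel (induced S W) R ∘ map ρ
open Retraction

id-retraction : {S : Structure τ A} {V : Pred A 0ℓ} → Closed S → univ S ⊆ V → Retraction S V id
id-retraction {S = S} {V} closed S⊆V = record
  { into      = λ u → u , S⊆V u
  ; fixes     = λ _ → refl
  ; preserves = λ R r → subst (rel (induced S V) R) (sym (map-id _)) (r , All.map S⊆V (closed R r))
  }

replace-retraction : {S : Structure τ A} (_≟_ : DecidableEquality A) {a c : A} →
                     Dominates S a c → univ S c → c ≢ a →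
                     Retraction S (_≢ a) (Replacement.replace _≟_ a c)
replace-retraction {S = S} _≟_ dom uc c≢a = record
  { into      = λ {x} u → replace-elim (univ S) x (λ _ → uc) (λ _ → u) , replace-≢ c≢a x
  ; fixes     = replace-other
  ; preserves = λ R {t} r → replace-all (rel S R) (dom R) t r
                          , map⁺ (All.universal (replace-≢ c≢a) t)
  }
  where open Replacement _≟_

∘-retraction : {S : Structure τ A} {U V : Pred A 0ℓ} {ρ σ : A → A} →
               Retraction S U ρ → Retraction (induced S U) V σ → Retraction S (U ∩ V) (σ ∘ ρ)
∘-retraction {S = S} {U} {V} {ρ} {σ} ρr σr = record
  { into      = λ u → let ((u′ , x∈U) , x∈V) = into σr (into ρr u) in u′ , x∈U , x∈V
  ; fixes     = λ (x∈U , x∈V) → trans (cong σ (fixes ρr x∈U)) (fixes σr x∈V)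
  ; preserves = λ R {t} r → let ((r′ , t∈U) , t∈V) = preserves σr R (preserves ρr R r) in
                  subst (rel (induced S (U ∩ V)) R) (sym (map-∘ σ ρ t)) (r′ , All.zip (t∈U , t∈V))
  }

retraction-resp-≐ : {S : Structure τ A} {U V : Pred A 0ℓ} {ρ : A → A} →
                    U ≐ V → Retraction S U ρ → Retraction S V ρ
retraction-resp-≐ (U⊆V , V⊆U) ρr = record
  { into      = map₂ U⊆V ∘ into ρr
  ; fixes     = fixes ρr ∘ V⊆U
  ; preserves = λ R → map₂ (All.map U⊆V) ∘ preserves ρr R
  }

restrict-retraction : {S : Structure τ A} {U V : Pred A 0ℓ} {ρ : A → A} →
                      U ⊆ V → Retraction S U ρ → Retraction (induced S V) U ρ
restrict-retraction U⊆V ρr = record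
  { into      = λ (u , _) → let (u′ , x∈U) = into ρr u in (u′ , U⊆V x∈U) , x∈U
  ; fixes     = fixes ρr
  ; preserves = λ R (r , _) → let (r′ , t∈U) = preserves ρr R r in (r′ , All.map U⊆V t∈U) , t∈U
  }

dismantling-retraction : {S : Structure τ A} {V : Pred A 0ℓ} →
                         DecidableEquality A → Closed S → Dismantles S V → ∃ (Retraction S V)
dismantling-retraction _ closed (stop S⊆V _) = id , id-retraction closed (S⊆V _)
dismantling-retraction _≟_ closed (step a b _ ub b≢a dom d) =
  let (ρ , ρr) = dismantling-retraction _≟_ (induced-closed closed) d in
  ρ ∘ Replacement.replace _≟_ a b ,
  retraction-resp-≐ (proj₂ , λ v → proj₂ (dismantles-⊆ d v) , v)
                    (∘-retraction (replace-retraction _≟_ dom ub b≢a) ρr)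

square-retraction : {S : Structure τ A} {W : Pred A 0ℓ} {ρ : A → A} →
                    Retraction S W ρ → Retraction (Square S) (W ⟨×⟩ W) (Data.Product.map ρ ρ)
square-retraction {A = A} {S = S} {ρ = ρ} ρr = record
  { into      = λ (u₁ , u₂) → let (u₁′ , w₁) = into ρr u₁ ; (u₂′ , w₂) = into ρr u₂ in
                                (u₁′ , u₂′) , w₁ , w₂
  ; fixes     = λ (w₁ , w₂) → cong₂ _,_ (fixes ρr w₁) (fixes ρr w₂)
  ; preserves = λ R {t} (r₁ , r₂) →
      let (r₁′ , t₁∈W) = preserves ρr R r₁ ; (r₂′ , t₂∈W) = preserves ρr R r₂ in
      (subst (rel S R) (sym (map-proj₁ t)) r₁′ , subst (rel S R) (sym (map-proj₂ t)) r₂′) ,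
      map⁺ (All.zip (map⁻ (map⁻ t₁∈W) , map⁻ (map⁻ t₂∈W)))
  }
  where
  ρ² : A × A → A × A
  ρ² = Data.Product.map ρ ρ

  map-proj₁ : ∀ {k} (t : Vec (A × A) k) → map proj₁ (map ρ² t) ≡ map ρ (map proj₁ t)
  map-proj₁ t = trans (sym (map-∘ proj₁ ρ² t)) (map-∘ ρ proj₁ t)

  map-proj₂ : ∀ {k} (t : Vec (A × A) k) → map proj₂ (map ρ² t) ≡ map ρ (map proj₂ t)
  map-proj₂ t = trans (sym (map-∘ proj₂ ρ² t)) (map-∘ ρ proj₂ t)

diagonal-retraction : {S : Structure τ A} → Retraction (Square S) Diagonal (diagonal ∘ proj₁)
diagonal-retraction {S = S} = record
  { into      = λ (u₁ , _) → (u₁ , u₁) , refl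
  ; fixes     = λ {p} x≡y → cong (proj₁ p ,_) x≡y
  ; preserves = λ R {t} (r₁ , _) →
      (subst (rel S R) (map-∘ proj₁ (diagonal ∘ proj₁) t) r₁ ,
       subst (rel S R) (map-∘ proj₂ (diagonal ∘ proj₁) t) r₁) ,
      map⁺ (All.universal (λ _ → refl) t)
  }

dominates-image : {S : Structure τ A} {W : Pred A 0ℓ} {ρ : A → A} {a b : A} →
                  Retraction S W ρ → Dominates S a b → Dominates (induced S W) a (ρ b)
dominates-image {S = S} {W} {ρ} {b = b} ρr dom R t i (r , t∈W) t[i]≡a =
  subst (rel (induced S W) R) t[i]≔ρb (preserves ρr R (dom R t i r t[i]≡a))
  where
  t[i]≔ρb : map ρ (t [ i ]≔ b) ≡ t [ i ]≔ ρ b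
  t[i]≔ρb = trans (map-[]≔ ρ t i) (cong (_[ i ]≔ ρ b) (map-fix (fixes ρr) t∈W))

module Transposition {A : Set} (_≟_ : DecidableEquality A) {S : Structure τ A} {W : Pred A 0ℓ}
  {ρ : A → A} (ρr : Retraction S W ρ) {a b : A} (ua : univ S a) (ub : univ S b) (b≢a : b ≢ a)
  (dom : Dominates S a b) (ρb≡a : ρ b ≡ a) where

  open Replacement _≟_
  open ≡-Reasoning

  σ : A → A
  σ = transpose a b

  W-≢b : ∀ {x} → W x → x ≢ b
  W-≢b w refl = b≢a (trans (sym (fixes ρr w)) ρb≡a)

  σ≡replace : ∀ {x} → W x → σ x ≡ replace a b x
  σ≡replace = transpose≡replace b≢a ∘ W-≢b

  ρ∘σ-fixes : ∀ {x} → W x → ρ (σ x) ≡ x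
  ρ∘σ-fixes {x} w = trans (cong ρ (σ≡replace w))
    (replace-elim (λ y → ρ y ≡ x) x (λ x≡a → trans ρb≡a (sym x≡a)) (λ _ → fixes ρr w))

  σ-univ : ∀ {x} → univ S x → univ S (σ x)
  σ-univ {x} = three-cases a b (λ y → univ S y → univ S (σ y))
    (λ _ → subst (univ S) (sym (transpose-first a b)) ub)
    (λ _ → subst (univ S) (sym (transpose-second b≢a)) ua)
    (λ y≢a y≢b u → subst (univ S) (sym (transpose-other y≢a y≢b)) u) x

  transpose-univ : ∀ {x} → univ S x → W x → univ (induced (remove S a) (W ∘ σ)) (σ x)
  transpose-univ {x} u w =
    (σ-univ u , subst (_≢ a) (sym (σ≡replace w)) (replace-≢ b≢a x)) ,
    subst W (sym (transpose-involutive b≢a x)) w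

  transpose-rel : ∀ {R t} → rel S R t → All W t → rel (induced (remove S a) (W ∘ σ)) R (map σ t)
  transpose-rel {R} {t} r t∈W =
    (subst (rel S R) (sym (map-cong-All σ≡replace t∈W)) (replace-all (rel S R) (dom R) t r) ,
     map⁺ (All.map (λ {x} w → subst (_≢ a) (sym (σ≡replace w)) (replace-≢ b≢a x)) t∈W)) ,
    map⁺ (All.map (λ {x} → subst W (sym (transpose-involutive b≢a x))) t∈W)

  transposed-retraction : Retraction (remove S a) (W ∘ σ) (σ ∘ ρ)
  transposed-retraction = record
    { into      = λ (u , _) → let (u′ , w) = into ρr u in transpose-univ u′ w
    ; fixes     = λ {x} w → begin
        σ (ρ x)         ≡⟨ cong (σ ∘ ρ) (sym (transpose-involutive b≢a x)) ⟩
        σ (ρ (σ (σ x))) ≡⟨ cong σ (ρ∘σ-fixes w) ⟩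
        σ (σ x)         ≡⟨ transpose-involutive b≢a x ⟩
        x               ∎
    ; preserves = λ R {t} (r , _) → let (r′ , t∈W) = preserves ρr R r in
                    subst (rel (induced (remove S a) (W ∘ σ)) R) (sym (map-∘ σ ρ t))
                          (transpose-rel r′ t∈W)
    }

  transposition-invariant : {T : Pred A 0ℓ} → T ⊆ (_≢ a) → T ⊆ W → T ∘ σ ≐ T
  transposition-invariant {T} T⊆≢a T⊆W =
    (λ {x} t → subst T (trans (sym (σ-fixes t)) (transpose-involutive b≢a x)) t) ,
    (λ t → subst T (sym (σ-fixes t)) t)
    where
    σ-fixes : ∀ {x} → T x → σ x ≡ x
    σ-fixes t = transpose-other (T⊆≢a t) (W-≢b (T⊆W t))

  transposed-isomorphism : IsIsomorphism (induced S W) (induced (remove S a) (W ∘ σ)) σ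
  transposed-isomorphism = record
    { injective = λ {x} {y} σx≡σy → trans (sym (transpose-involutive b≢a x))
                                          (trans (cong σ σx≡σy) (transpose-involutive b≢a y))
    ; onto      = λ {y} _ → σ y , transpose-involutive b≢a y
    ; univ-≐    = (λ (u , w) → transpose-univ u w)
                , (λ {x} ((u , _) , w) → subst (univ S) (transpose-involutive b≢a x) (σ-univ u)
                                         , subst W (transpose-involutive b≢a x) w)
    ; rel-≐     = λ R → (λ (r , t∈W) → transpose-rel r t∈W)
                      , (λ {t} ((r , _) , σt∈W) →
                           let t∈W = All.map (λ {x} → subst W (transpose-involutive b≢a x))
                                             (map⁻ σt∈W) in
                           subst (rel S R) (ρ∘σ-map t∈W) (proj₁ (preserves ρr R r)) , t∈W)
    }
    where
    ρ∘σ-map : ∀ {k} {t : Vec A k} → All W t → map ρ (map σ t) ≡ t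
    ρ∘σ-map {t = t} t∈W = trans (sym (map-∘ ρ σ t)) (map-fix ρ∘σ-fixes t∈W)

retract-dismantles : {S : Structure τ A} {W T : Pred A 0ℓ} {ρ : A → A} →
                     DecidableEquality A → Decidable W → T ⊆ W → Retraction S W ρ →
                     Dismantles S T → Dismantles (induced S W) T
retract-dismantles _ _ T⊆W _ (stop S⊆T T⊆S) = stop (λ x (u , _) → S⊆T x u) (λ x t → T⊆S x t , T⊆W t)
retract-dismantles {S = S} {W} {T} {ρ} _≟_ W? T⊆W ρr (step a b ua ub b≢a dom d)
  with W? a | ρ b ≟ a
... | no a∉W | _ =
  dismantles-respˡ-≈ (induced-cong ((λ w → W⊆≢a w , w) , proj₂))
    (dismantles-respˡ-≈ (≈-sym induced-∩)
      (retract-dismantles _≟_ W? T⊆W (restrict-retraction W⊆≢a ρr) d))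
  where
  W⊆≢a : W ⊆ (_≢ a)
  W⊆≢a w refl = a∉W w
... | yes a∈W | no ρb≢a =
  step a (ρ b) (ua , a∈W) (into ρr ub) ρb≢a (dominates-image ρr dom)
    (dismantles-respˡ-≈ induced-∩
      (dismantles-respˡ-≈ (induced-cong ((λ (w , x≢a) → x≢a , w , x≢a) , proj₂))
        (dismantles-respˡ-≈ (≈-sym induced-∩)
          (retract-dismantles _≟_ (W? ∩? λ x → ¬? (x ≟ a)) (λ t → T⊆W t , proj₂ (dismantles-⊆ d t))
            (restrict-retraction proj₂ folded) d))))
  where
  folded : Retraction S (W ∩ (_≢ a)) (Replacement.replace _≟_ a (ρ b) ∘ ρ)
  folded = ∘-retraction ρr (replace-retraction _≟_ (dominates-image ρr dom) (into ρr ub) ρb≢a)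
... | yes _ | yes ρb≡a =
  -- Now b ∉ W, and exchanging a and b maps S[W] isomorphically onto a retract of S − a.
  dismantles-respʳ-≐ T∘σ≐T
    (dismantles-transport transposed-isomorphism
      (retract-dismantles _≟_ (W? ∘ σ) (λ t → T⊆W (proj₂ T∘σ≐T t)) transposed-retraction d))
  where
  open Transposition _≟_ ρr ua ub b≢a dom ρb≡a
  T∘σ≐T : T ∘ σ ≐ T
  T∘σ≐T = transposition-invariant (λ t → proj₂ (dismantles-⊆ d t)) T⊆W

lemma4p4 : (τ : Signature) (n : ℕ) (H : Structure τ (Fin n)) →
    (∀ x → univ H x) →
    (J : Pred (Fin n) 0ℓ) (K : Pred (Fin n × Fin n) 0ℓ) →
    Dismantles (Square H) K →
    (∀ a → J a → K (a , a)) →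
    (∀ p → K p → proj₁ p ≡ proj₂ p) →
    Σ (Pred (Fin n) 0ℓ) λ I →
    Dismantles H I × (∀ a → J a → I a) ×
    Dismantles (Square (induced H I)) (λ p → I (proj₁ p) × proj₁ p ≡ proj₂ p)
lemma4p4 _ n H total _ K H²↠K J⊆I K⊆Δ = I , H↠I , J⊆I , I²↠Δ
  where
  I : Pred (Fin n) 0ℓ
  I a = K (a , a)

  _≟²_ : DecidableEquality (Fin n × Fin n)
  _≟²_ = Product.≡-dec Fin._≟_ Fin._≟_

  H↠I : Dismantles H I
  H↠I = dismantles-transport diagonal-isomorphism
          (retract-dismantles _≟²_ (λ p → proj₁ p Fin.≟ proj₂ p) (K⊆Δ _)
             (diagonal-retraction {S = H}) H²↠K)

  H-closed : Closed H
  H-closed R {t} _ = All.universal total t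

  I? : Decidable I
  I? = dismantles-decidable Fin._≟_ (yes ∘ total) H↠I

  K⊆I×I : K ⊆ (I ⟨×⟩ I)
  K⊆I×I {x , y} k = subst (λ z → K (x , z)) (sym (K⊆Δ _ k)) k , subst (λ z → K (z , y)) (K⊆Δ _ k) k

  H²[I×I]↠K : Dismantles (induced (Square H) (I ⟨×⟩ I)) K
  H²[I×I]↠K = retract-dismantles _≟²_ (I? ×? I?) K⊆I×I
                (square-retraction (proj₂ (dismantling-retraction Fin._≟_ H-closed H↠I))) H²↠K

  I²↠Δ : Dismantles (Square (induced H I)) (λ p → I (proj₁ p) × proj₁ p ≡ proj₂ p)
  I²↠Δ = dismantles-respʳ-≐
           ((λ k → proj₁ (K⊆I×I k) , K⊆Δ _ k) , λ {p} (i , x≡y) → subst (λ z → K (proj₁ p , z)) x≡y i)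
           (dismantles-respˡ-≈ (square-induced {S = H}) H²[I×I]↠K)
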